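{- Let $M$ be a matroid of rank $n$ on ground set $E$, and let $e\in E$. For every family $\{A_1,\dots,A_n\}$ of subsets of $E$ such that each $A_i$ contains $e$ in its closure, the family has a rainbow set whose closure contains $e$.
   Context: Closure refers to the closure (span) operator of $M$. A family means a multiset. Given a family $\mathcal{E}$ of sets, an $\mathcal{E}$-rainbow set is a set $R\subseteq\bigcup\mathcal{E}$ with an injection $\sigma:R\to\mathcal{E}$ such that $x\in\sigma(x)$ for all $x\in R$. -}

module Defs where

open import Data.Nat using (ℕ; _+_; _≤_)
open import Data.Fin using (Fin)
open import Data.Fin.Subset using (Subset; _∪_; _∩_; _⊆_; ∣_∣; ⁅_⁆; _∈_)
open import Data.Product using (Σ; _×_)
open import Relation.Binary.PropositionalEquality using (_≡_)

record Matroid (m : ℕ) : Set where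
  field
    rk          : Subset m → ℕ
    rk-bounded  : ∀ X → rk X ≤ ∣ X ∣
    rk-mono     : ∀ {X Y} → X ⊆ Y → rk X ≤ rk Y
    rk-submod   : ∀ X Y → rk (X ∪ Y) + rk (X ∩ Y) ≤ rk X + rk Y

open Matroid public

InClosure : ∀ {m} (M : Matroid m) → Fin m → Subset m → Set
InClosure M x X = rk M (X ∪ ⁅ x ⁆) ≡ rk M X

-- R is a rainbow set of the family A (indexed by Fin n, repetitions allowed):
-- there is an injection σ : R → Fin n with x ∈ A (σ x) for all x ∈ R.
IsRainbow : ∀ {m n} → (Fin n → Subset m) → Subset m → Set
IsRainbow {m} {n} A R =
  Σ ((x : Fin m) → x ∈ R → Fin n) λ σ →
    (∀ x (p : x ∈ R) → x ∈ A (σ x p)) ×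
    (∀ x y (p : x ∈ R) (q : y ∈ R) → σ x p ≡ σ y q → x ≡ y)

-- Grow a set C of chosen elements, keeping the invariant r(E) ≤ (number of
-- unused colours) + r(C) and e ∈ cl(C ∪ Aᵢ) for the unused colours i.  If A₀ ⊆ cl C, then e ∈ cl(C ∪ A₀) = cl C and the empty
-- rainbow set already works.  Otherwise pick x ∈ A₀ outside cl C: adding x to
-- C raises its rank by one, which pays for the used colour, and x joins the
-- rainbow set with colour A₀.  When no colours are left, r(E) ≤ r(C) forces
-- e ∈ cl C.
module Submission where

open import Defs
open import Data.Nat using (ℕ; zero; suc; _+_; _≤_)
open import Data.Nat.Properties
  using ( ≤-refl; ≤-reflexive; ≤-trans; ≤-antisym; ≤-pred; <-≤-trans; n≮0; ≤∧≢⇒<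
        ; +-comm; +-suc; +-monoʳ-≤; +-cancelʳ-≤; m≤m+n; _≟_)
open import Data.Fin using (Fin)
import Data.Fin as Fin
open import Data.Fin.Properties using (any?; suc-injective)
open import Data.Fin.Subset using (Subset; ⊤; ⊥; _∪_; _∩_; _⊆_; _-_; ∣_∣; ⁅_⁆; _∈_)
open import Data.Fin.Subset.Properties
  using ( p⊆p∪q; q⊆p∪q; x∈p∪q⁻; x∈p∩q⁺; x∈⁅x⁆; x∈⁅y⁆⇒x≡y; ∣⁅x⁆∣≡1; ∉⊥; ⊆⊤
        ; ⊆-reflexive; ⊆-trans; _∈?_; nonempty?; p─q⊆p; x∈p∧x≢y⇒x∈p-y; x∈p⇒∣p-x∣<∣p∣
        ; ∪-assoc; ∪-identityˡ)
open import Data.Product using (Σ; ∃; _×_; _,_)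
open import Data.Sum using (_⊎_; inj₁; inj₂)
open import Data.Empty using (⊥-elim)
open import Function using (_∘_; id)
open import Relation.Binary.PropositionalEquality using (_≡_; _≢_; refl; sym; trans; cong; subst)
open import Relation.Nullary using (¬_; Dec; yes; no; ¬?)
open import Relation.Nullary.Decidable using (_×-dec_; decidable-stable)

m+n≤o+p∧p≤n⇒m≤o : ∀ {m n o p} → m + n ≤ o + p → p ≤ n → m ≤ o
m+n≤o+p∧p≤n⇒m≤o {m} {n} {o} m+n≤o+p p≤n =
  +-cancelʳ-≤ n m o (≤-trans m+n≤o+p (+-monoʳ-≤ o p≤n))

module _ {m : ℕ} where

  ∪-least : {p q r : Subset m} → p ⊆ r → q ⊆ r → p ∪ q ⊆ r
  ∪-least {p} {q} p⊆r q⊆r x∈p∪q with x∈p∪q⁻ p q x∈p∪q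
  ... | inj₁ x∈p = p⊆r x∈p
  ... | inj₂ x∈q = q⊆r x∈q

  ∪-mono : {p p′ q q′ : Subset m} → p ⊆ p′ → q ⊆ q′ → p ∪ q ⊆ p′ ∪ q′
  ∪-mono {p′ = p′} {q′ = q′} p⊆p′ q⊆q′ =
    ∪-least (⊆-trans p⊆p′ (p⊆p∪q q′)) (⊆-trans q⊆q′ (q⊆p∪q p′ q′))

  ∩-greatest : {p q r : Subset m} → r ⊆ p → r ⊆ q → r ⊆ p ∩ q
  ∩-greatest r⊆p r⊆q x∈r = x∈p∩q⁺ (r⊆p x∈r , r⊆q x∈r)

  p⊆p-x∪⁅x⁆ : {p : Subset m} (x : Fin m) → p ⊆ (p - x) ∪ ⁅ x ⁆
  p⊆p-x∪⁅x⁆ {p} x {y} y∈p with y Fin.≟ x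
  ... | yes refl = q⊆p∪q (p - x) ⁅ x ⁆ (x∈⁅x⁆ x)
  ... | no y≢x   = p⊆p∪q ⁅ x ⁆ (x∈p∧x≢y⇒x∈p-y y∈p y≢x)

module _ {m n : ℕ} where

  IsRainbow-⊥ : (A : Fin n → Subset m) → IsRainbow A ⊥
  IsRainbow-⊥ A = (λ _ x∈⊥ → ⊥-elim (∉⊥ x∈⊥)) , (λ _ x∈⊥ → ⊥-elim (∉⊥ x∈⊥)) ,
                  (λ _ _ x∈⊥ _ _ → ⊥-elim (∉⊥ x∈⊥))

  IsRainbow-∪-⁅⁆ : ∀ {A : Fin (suc n) → Subset m} {R x} →
                   IsRainbow (A ∘ Fin.suc) R → x ∈ A Fin.zero → IsRainbow A (R ∪ ⁅ x ⁆)
  IsRainbow-∪-⁅⁆ {A} {R} {x} (σ , σ-colours , σ-injective) x∈A₀ = colour , colours , injective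
    where
    ∈R : ∀ {y} → y ∈ R ∪ ⁅ x ⁆ → y ≢ x → y ∈ R
    ∈R {y} y∈R∪x y≢x with x∈p∪q⁻ R ⁅ x ⁆ y∈R∪x
    ... | inj₁ y∈R = y∈R
    ... | inj₂ y∈⁅x⁆ = ⊥-elim (y≢x (x∈⁅y⁆⇒x≡y x y∈⁅x⁆))

    colour : ∀ y → y ∈ R ∪ ⁅ x ⁆ → Fin (suc n)
    colour y y∈ with y Fin.≟ x
    ... | yes _   = Fin.zero
    ... | no y≢x = Fin.suc (σ y (∈R y∈ y≢x))

    colours : ∀ y (y∈ : y ∈ R ∪ ⁅ x ⁆) → y ∈ A (colour y y∈)
    colours y y∈ with y Fin.≟ x
    ... | yes refl = x∈A₀
    ... | no y≢x  = σ-colours y (∈R y∈ y≢x)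

    injective : ∀ y z (y∈ : y ∈ R ∪ ⁅ x ⁆) (z∈ : z ∈ R ∪ ⁅ x ⁆) →
                colour y y∈ ≡ colour z z∈ → y ≡ z
    injective y z y∈ z∈ same with y Fin.≟ x | z Fin.≟ x
    ... | yes y≡x | yes z≡x = trans y≡x (sym z≡x)
    ... | no y≢x  | no z≢x  = σ-injective y z _ _ (suc-injective same)

module MatroidProperties {m : ℕ} (M : Matroid m) where

  private
    r = rk M

  rk-≡-⊆ : ∀ {X Y} → X ⊆ Y → r Y ≤ r X → r Y ≡ r X
  rk-≡-⊆ X⊆Y rY≤rX = ≤-antisym rY≤rX (rk-mono M X⊆Y)

  InClosure-intro : ∀ {x X} → r (X ∪ ⁅ x ⁆) ≤ r X → InClosure M x X
  InClosure-intro {x} {X} = rk-≡-⊆ (p⊆p∪q ⁅ x ⁆)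

  InClosure? : ∀ x X → Dec (InClosure M x X)
  InClosure? x X = r (X ∪ ⁅ x ⁆) ≟ r X

  rk-∪-⁅⁆-≤ : ∀ X x → r (X ∪ ⁅ x ⁆) ≤ suc (r X)
  rk-∪-⁅⁆-≤ X x = begin
    r (X ∪ ⁅ x ⁆)                    ≤⟨ m≤m+n _ _ ⟩
    r (X ∪ ⁅ x ⁆) + r (X ∩ ⁅ x ⁆)    ≤⟨ rk-submod M X ⁅ x ⁆ ⟩
    r X + r ⁅ x ⁆                    ≤⟨ +-monoʳ-≤ (r X) rk⁅x⁆≤1 ⟩
    r X + 1                          ≡⟨ +-comm (r X) 1 ⟩
    suc (r X)                        ∎
    where
    open Data.Nat.Properties.≤-Reasoning
    rk⁅x⁆≤1 : r ⁅ x ⁆ ≤ 1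
    rk⁅x⁆≤1 = subst (r ⁅ x ⁆ ≤_) (∣⁅x⁆∣≡1 x) (rk-bounded M ⁅ x ⁆)

  ¬InClosure⇒rk-suc : ∀ {x X} → ¬ InClosure M x X → r (X ∪ ⁅ x ⁆) ≡ suc (r X)
  ¬InClosure⇒rk-suc {x} {X} x∉clX =
    ≤-antisym (rk-∪-⁅⁆-≤ X x) (≤∧≢⇒< (rk-mono M (p⊆p∪q ⁅ x ⁆)) (x∉clX ∘ sym))

  -- Submodularity: X adds nothing over its subset Z, hence nothing over any Y ⊇ Z.
  rk-∪-redundant : ∀ {X Y Z} → Z ⊆ X → Z ⊆ Y → r X ≡ r Z → r (X ∪ Y) ≤ r Y
  rk-∪-redundant {X} {Y} {Z} Z⊆X Z⊆Y rX≡rZ = m+n≤o+p∧p≤n⇒m≤o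
    (subst (r (X ∪ Y) + r (X ∩ Y) ≤_) (trans (cong (_+ r Y) rX≡rZ) (+-comm (r Z) (r Y)))
      (rk-submod M X Y))
    (rk-mono M (∩-greatest Z⊆X Z⊆Y))

  InClosure-mono : ∀ {x X Y} → X ⊆ Y → InClosure M x X → InClosure M x Y
  InClosure-mono {x} {X} {Y} X⊆Y x∈clX = InClosure-intro (begin
    r (Y ∪ ⁅ x ⁆)              ≤⟨ rk-mono M Y∪x⊆ ⟩
    r ((X ∪ ⁅ x ⁆) ∪ Y)        ≤⟨ rk-∪-redundant (p⊆p∪q ⁅ x ⁆) X⊆Y x∈clX ⟩
    r Y                        ∎)
    where
    open Data.Nat.Properties.≤-Reasoning
    Y∪x⊆ : Y ∪ ⁅ x ⁆ ⊆ (X ∪ ⁅ x ⁆) ∪ Y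
    Y∪x⊆ = ∪-least (q⊆p∪q (X ∪ ⁅ x ⁆) Y) (⊆-trans (q⊆p∪q X ⁅ x ⁆) (p⊆p∪q Y))

  rk-∪-∪-stable : ∀ C B D → r (C ∪ B) ≡ r C → r (C ∪ D) ≡ r C → r ((C ∪ B) ∪ D) ≡ r C
  rk-∪-∪-stable C B D rC∪B≡rC rC∪D≡rC = rk-≡-⊆ (⊆-trans (p⊆p∪q B) (p⊆p∪q D)) (begin
    r ((C ∪ B) ∪ D)            ≤⟨ rk-mono M (∪-mono id (q⊆p∪q C D)) ⟩
    r ((C ∪ B) ∪ (C ∪ D))      ≤⟨ rk-∪-redundant (p⊆p∪q B) (p⊆p∪q D) rC∪B≡rC ⟩
    r (C ∪ D)                  ≡⟨ rC∪D≡rC ⟩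
    r C                        ∎)
    where open Data.Nat.Properties.≤-Reasoning

  rk-∪-spanned : ∀ C A → (∀ {x} → x ∈ A → InClosure M x C) → r (C ∪ A) ≡ r C
  rk-∪-spanned C A = bounded ∣ A ∣ A ≤-refl
    where
    bounded : ∀ k A → ∣ A ∣ ≤ k → (∀ {x} → x ∈ A → InClosure M x C) → r (C ∪ A) ≡ r C
    bounded k A _ _ with nonempty? A
    ... | no A-empty =
      rk-≡-⊆ (p⊆p∪q A) (rk-mono M (∪-least id (λ x∈A → ⊥-elim (A-empty (_ , x∈A)))))
    bounded zero A ∣A∣≤0 _ | yes (x , x∈A) =
      ⊥-elim (n≮0 (<-≤-trans (x∈p⇒∣p-x∣<∣p∣ x∈A) ∣A∣≤0))
    bounded (suc k) A ∣A∣≤1+k spanned | yes (x , x∈A) = rk-≡-⊆ (p⊆p∪q A) (begin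
      r (C ∪ A)                  ≤⟨ rk-mono M C∪A⊆ ⟩
      r ((C ∪ (A - x)) ∪ ⁅ x ⁆)  ≡⟨ rk-∪-∪-stable C (A - x) ⁅ x ⁆ rest-spanned (spanned x∈A) ⟩
      r C                        ∎)
      where
      open Data.Nat.Properties.≤-Reasoning
      C∪A⊆ : C ∪ A ⊆ (C ∪ (A - x)) ∪ ⁅ x ⁆
      C∪A⊆ = ⊆-trans (∪-mono id (p⊆p-x∪⁅x⁆ x)) (⊆-reflexive (sym (∪-assoc C (A - x) ⁅ x ⁆)))
      rest-spanned : r (C ∪ (A - x)) ≡ r C
      rest-spanned = bounded k (A - x) (≤-pred (<-≤-trans (x∈p⇒∣p-x∣<∣p∣ x∈A) ∣A∣≤1+k))
                       (spanned ∘ p─q⊆p A ⁅ x ⁆)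

  InClosure-∪-spanned : ∀ {e C A} → (∀ {x} → x ∈ A → InClosure M x C) →
                        InClosure M e (C ∪ A) → InClosure M e C
  InClosure-∪-spanned {e} {C} {A} spanned e∈clC∪A = InClosure-intro (begin
    r (C ∪ ⁅ e ⁆)              ≤⟨ rk-mono M (∪-mono (p⊆p∪q A) id) ⟩
    r ((C ∪ A) ∪ ⁅ e ⁆)        ≡⟨ e∈clC∪A ⟩
    r (C ∪ A)                  ≡⟨ rk-∪-spanned C A spanned ⟩
    r C                        ∎)
    where open Data.Nat.Properties.≤-Reasoning

  spanned-or-escaping : ∀ C A → (∀ {x} → x ∈ A → InClosure M x C) ⊎
                                ∃ λ x → x ∈ A × ¬ InClosure M x C
  spanned-or-escaping C A with any? (λ x → (x ∈? A) ×-dec ¬? (InClosure? x C))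
  ... | yes escaping = inj₂ escaping
  ... | no ¬escaping = inj₁ λ {x} x∈A →
    decidable-stable (InClosure? x C) (λ x∉clC → ¬escaping (x , x∈A , x∉clC))

module _ {m : ℕ} (M : Matroid m) (e : Fin m) where

  open MatroidProperties M

  RainbowSpanning : ∀ {n} → Subset m → (Fin n → Subset m) → Set
  RainbowSpanning C A = Σ (Subset m) λ R → IsRainbow A R × InClosure M e (C ∪ R)

  RainbowSpanning-⊥ : ∀ {n C} (A : Fin n → Subset m) → InClosure M e C → RainbowSpanning C A
  RainbowSpanning-⊥ A e∈clC = ⊥ , IsRainbow-⊥ A , InClosure-mono (p⊆p∪q ⊥) e∈clC

  RainbowSpanning-∷ : ∀ {n C x} {A : Fin (suc n) → Subset m} → x ∈ A Fin.zero →
                      RainbowSpanning (C ∪ ⁅ x ⁆) (A ∘ Fin.suc) → RainbowSpanning C A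
  RainbowSpanning-∷ {C = C} {x} {A} x∈A₀ (R , R-rainbow , e∈clC∪x∪R) =
    R ∪ ⁅ x ⁆ , IsRainbow-∪-⁅⁆ {A = A} R-rainbow x∈A₀ , InClosure-mono C∪x∪R⊆ e∈clC∪x∪R
    where
    C∪x∪R⊆ : (C ∪ ⁅ x ⁆) ∪ R ⊆ C ∪ (R ∪ ⁅ x ⁆)
    C∪x∪R⊆ = ∪-least (∪-mono id (q⊆p∪q R ⁅ x ⁆)) (⊆-trans (p⊆p∪q ⁅ x ⁆) (q⊆p∪q C _))

  rainbowSpanning : ∀ n C (A : Fin n → Subset m) → rk M ⊤ ≤ n + rk M C →
                    (∀ i → InClosure M e (C ∪ A i)) → RainbowSpanning C A
  rainbowSpanning zero C A rank-bound _ = RainbowSpanning-⊥ A (InClosure-intro (begin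
    rk M (C ∪ ⁅ e ⁆)  ≤⟨ rk-mono M ⊆⊤ ⟩
    rk M ⊤            ≤⟨ rank-bound ⟩
    rk M C            ∎))
    where open Data.Nat.Properties.≤-Reasoning
  rainbowSpanning (suc n) C A rank-bound e∈cl with spanned-or-escaping C (A Fin.zero)
  ... | inj₁ A₀-spanned = RainbowSpanning-⊥ A (InClosure-∪-spanned A₀-spanned (e∈cl Fin.zero))
  ... | inj₂ (x , x∈A₀ , x∉clC) = RainbowSpanning-∷ {A = A} x∈A₀
      (rainbowSpanning n (C ∪ ⁅ x ⁆) (A ∘ Fin.suc) rank-bound′
        (λ i → InClosure-mono (∪-mono (p⊆p∪q ⁅ x ⁆) id) (e∈cl (Fin.suc i))))
    where
    rank-bound′ : rk M ⊤ ≤ n + rk M (C ∪ ⁅ x ⁆)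
    rank-bound′ = subst (rk M ⊤ ≤_)
      (trans (sym (+-suc n (rk M C))) (cong (n +_) (sym (¬InClosure⇒rk-suc x∉clC))))
      rank-bound

proposition5p1 : (m n : ℕ) (M : Matroid m) → rk M ⊤ ≡ n → (e : Fin m)
    → (A : Fin n → Subset m) → (∀ i → InClosure M e (A i))
    → Σ (Subset m) λ R → IsRainbow A R × InClosure M e R
proposition5p1 m n M rank≡n e A e∈clA
  with rainbowSpanning M e n ⊥ A (≤-trans (≤-reflexive rank≡n) (m≤m+n n _))
         (λ i → subst (InClosure M e) (sym (∪-identityˡ (A i))) (e∈clA i))
... | R , R-rainbow , e∈cl⊥∪R = R , R-rainbow , subst (InClosure M e) (∪-identityˡ R) e∈cl⊥∪R
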